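{- Let $K\ge1$, $m=2^K-1$, $B=2^{2^K}$, and $\Delta(n)=a_m(n)\oplus a_m(n+1)$ for $n\ge0$. Then for all $q\ge0$ and $0\le r<B$, \[ \Delta(qB+r)=\begin{cases}1,&0\le r\le B-2,\\ 1-\Delta(q),&r=B-1.\end{cases} \] In particular, $\Delta$ is the fixed point beginning with $1$ of the uniform substitution $1\mapsto 1^{B-1}0$, $0\mapsto 1^B$. Moreover, $00$ is not a factor of $\Delta$.
   Context: For $n\ge0$ write $b_p(n)=\lfloor n/2^p\rfloor\bmod 2$; $\oplus$ is XOR and $\&$ is bitwise AND. For $m\ge0$, $a_m(n)=\bigoplus_{p\ge0,\ p\,\&\,m=0}b_p(n)$. -}

module Defs where

open import Data.Nat using (ℕ; zero; suc; _+_; _*_; _∸_; _^_)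
open import Data.Nat.DivMod using (_/_; _%_)
open import Data.Nat.Properties using (m^n≢0; _≟_)
open import Relation.Nullary using (yes; no)

b : ℕ → ℕ → ℕ
b p n = (n / (2 ^ p)) {{m^n≢0 2 p}} % 2

_⊕_ : ℕ → ℕ → ℕ
x ⊕ y = (x + y) % 2

-- bitwise AND:  p & m = Σ_{i < p} 2^i · b_i(p) · b_i(m)
-- (all bits of p at positions i ≥ p vanish, so this sum covers every nonzero bit)
andSum : ℕ → ℕ → ℕ → ℕ
andSum zero    p m = 0
andSum (suc k) p m = andSum k p m + 2 ^ k * (b k p * b k m)

_&_ : ℕ → ℕ → ℕ
p & m = andSum p p m

term : ℕ → ℕ → ℕ → ℕ
term m n p with p & m ≟ 0
... | yes _ = b p n
... | no  _ = 0

xorUpTo : ℕ → ℕ → ℕ → ℕ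
xorUpTo m n zero    = 0
xorUpTo m n (suc k) = xorUpTo m n k ⊕ term m n k

-- a_m(n) = ⊕_{p ≥ 0, p & m = 0} b_p(n); b_p(n) = 0 for p ≥ n (as 2^p > n),
-- so the range p < n covers all nonzero terms.
a : ℕ → ℕ → ℕ
a m n = xorUpTo m n n

Δ : ℕ → ℕ → ℕ
Δ K n = a (2 ^ K ∸ 1) n ⊕ a (2 ^ K ∸ 1) (suc n)

Bsz : ℕ → ℕ
Bsz K = 2 ^ (2 ^ K)

-- uniform substitution of length B: 1 ↦ 1^(B-1) 0, 0 ↦ 1^B;
-- σ K x r is the r-th letter (0 ≤ r < B) of the image of the letter x.
σ : ℕ → ℕ → ℕ → ℕ
σ K zero    r = 1
σ K (suc _) r with suc r ≟ Bsz K
... | yes _ = 0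
... | no  _ = 1

-- Since m = 2^K − 1, we have p & m = p mod 2^K, so a_m(n) is the parity of the bits of n at
-- positions divisible by 2^K. Writing n = qB + r with r < B = 2^(2^K), bit 0 of n is bit 0 of r,
-- bit 2^K + k of n is bit k of q, and the positions strictly between 0 and 2^K are ignored; hence
-- a_m(qB + r) = r ⊕ a_m(q). So Δ(qB + r) = r ⊕ (r + 1) = 1 when r + 1 < B, and at r = B − 1 the carry
-- into q gives Δ = 1 ⊕ a_m(q) ⊕ a_m(q + 1) = 1 − Δ(q). Every block of B ≥ 2 letters thus has at most
-- one 0, at its end, so 00 never occurs.
module Submission where

open import Defs
open import Data.Nat using (ℕ; zero; suc; _+_; _*_; _∸_; _^_; _<_; _≤_; _≥_; z≤n; s≤s; z<s; NonZero; _/_; _%_)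
open import Data.Nat.Properties
open import Data.Nat.DivMod
open import Data.Nat.Divisibility using (_∣_; m∣m*n; n∣m*n; ∣-trans)
open import Data.Nat.Tactic.RingSolver using (solve-∀)
open import Data.Product using (_×_; _,_)
open import Data.Sum using (_⊎_; inj₁; inj₂)
open import Data.Empty using (⊥-elim)
open import Function using (_∘_)
open import Relation.Binary.PropositionalEquality
open import Relation.Nullary using (¬_; yes; no)

open ≡-Reasoning

n<2^n : ∀ n → n < 2 ^ n
n<2^n zero    = z<s
n<2^n (suc n) = ≤-trans (+-mono-≤ (m^n>0 2 n) (n<2^n n))
                        (≤-reflexive (cong (2 ^ n +_) (sym (+-identityʳ (2 ^ n)))))

2∣2^n : ∀ {e} → 1 ≤ e → 2 ∣ 2 ^ e
2∣2^n {suc e} _ = m∣m*n (2 ^ e)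

2*n∸1≡1+2*[n∸1] : ∀ {n} → 1 ≤ n → 2 * n ∸ 1 ≡ 1 + 2 * (n ∸ 1)
2*n∸1≡1+2*[n∸1] {suc n} _ = +-suc n (n + 0)

[1+2*n]/2≡n : ∀ n → (1 + 2 * n) / 2 ≡ n
[1+2*n]/2≡n n = begin
  (1 + 2 * n) / 2     ≡⟨ +-distrib-/-∣ʳ 1 {2 * n} {2} (m∣m*n n) ⟩
  2 * n / 2           ≡⟨ cong (_/ 2) (*-comm 2 n) ⟩
  n * 2 / 2           ≡⟨ m*n/n≡m n 2 ⟩
  n                   ∎

_%2^_ : ℕ → ℕ → ℕ
n %2^ k = _%_ n (2 ^ k) {{m^n≢0 2 k}}

b-zero : ∀ n → b 0 n ≡ n % 2
b-zero n = cong (_% 2) (n/1≡n n)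

b-suc : ∀ k n → b (suc k) n ≡ b k (n / 2)
b-suc k n = cong (_% 2) (sym (m/n/o≡m/[n*o] n 2 (2 ^ k) {{_}} {{m^n≢0 2 k}} {{m^n≢0 2 (suc k)}}))

b-< : ∀ {k n} → n < 2 ^ k → b k n ≡ 0
b-< {k} n<2^k = cong (_% 2) (m<n⇒m/n≡0 {{m^n≢0 2 k}} n<2^k)

%2^-suc : ∀ k p → p %2^ suc k ≡ p %2^ k + 2 ^ k * b k p
%2^-suc k p = begin
  p % (2 * n)                   ≡⟨ cong (_% (2 * n)) (trans (m≡m%n+[m/n]*n p n) (+-comm (p % n) _)) ⟩
  (p / n * n + p % n) % (2 * n) ≡⟨ [m*n+o]%[p*n]≡[m*n]%[p*n]+o (p / n) 2 (m%n<n p n) ⟩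
  p / n * n % (2 * n) + p % n   ≡⟨ cong (_+ p % n) (m%n*o≡m*o%[n*o] (p / n) 2 n) ⟨
  b k p * n + p % n             ≡⟨ +-comm (b k p * n) _ ⟩
  p % n + b k p * n             ≡⟨ cong (p % n +_) (*-comm (b k p) n) ⟩
  p % n + n * b k p             ∎
  where
  n : ℕ
  n = 2 ^ k
  instance
    2^k≢0 : NonZero n
    2^k≢0 = m^n≢0 2 k
    2^1+k≢0 : NonZero (2 * n)
    2^1+k≢0 = m^n≢0 2 (suc k)

b-2^k∸1-low : ∀ {i k} → i < k → b i (2 ^ k ∸ 1) ≡ 1
b-2^k∸1-low {zero} {suc k} _ = begin
  b 0 (2 ^ suc k ∸ 1)           ≡⟨ b-zero (2 ^ suc k ∸ 1) ⟩
  (2 ^ suc k ∸ 1) % 2           ≡⟨ cong (_% 2) (2*n∸1≡1+2*[n∸1] (m^n>0 2 k)) ⟩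
  (1 + 2 * (2 ^ k ∸ 1)) % 2     ≡⟨ cong (λ x → (1 + x) % 2) (*-comm 2 (2 ^ k ∸ 1)) ⟩
  (1 + (2 ^ k ∸ 1) * 2) % 2     ≡⟨ [m+kn]%n≡m%n 1 (2 ^ k ∸ 1) 2 ⟩
  1                             ∎
b-2^k∸1-low {suc i} {suc k} (s≤s i<k) = begin
  b (suc i) (2 ^ suc k ∸ 1)         ≡⟨ b-suc i _ ⟩
  b i ((2 ^ suc k ∸ 1) / 2)         ≡⟨ cong (λ x → b i (x / 2)) (2*n∸1≡1+2*[n∸1] (m^n>0 2 k)) ⟩
  b i ((1 + 2 * (2 ^ k ∸ 1)) / 2)   ≡⟨ cong (b i) ([1+2*n]/2≡n (2 ^ k ∸ 1)) ⟩
  b i (2 ^ k ∸ 1)                   ≡⟨ b-2^k∸1-low i<k ⟩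
  1                                 ∎

b-2^k∸1-high : ∀ {i k} → k ≤ i → b i (2 ^ k ∸ 1) ≡ 0
b-2^k∸1-high {i} {k} k≤i =
  b-< {i} (<-≤-trans (∸-monoʳ-< z<s (m^n>0 2 k)) (^-monoʳ-≤ 2 k≤i))

andSum-2^K∸1-low : ∀ {K k} p → k ≤ K → andSum k p (2 ^ K ∸ 1) ≡ p %2^ k
andSum-2^K∸1-low {K} {zero}  p _   = sym (n%1≡0 p)
andSum-2^K∸1-low {K} {suc k} p k<K = begin
  andSum k p (2 ^ K ∸ 1) + 2 ^ k * (b k p * b k (2 ^ K ∸ 1))
    ≡⟨ cong₂ (λ x y → x + 2 ^ k * (b k p * y))
             (andSum-2^K∸1-low {K} {k} p (<⇒≤ k<K)) (b-2^k∸1-low k<K) ⟩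
  p %2^ k + 2 ^ k * (b k p * 1) ≡⟨ cong (λ x → p %2^ k + 2 ^ k * x) (*-identityʳ (b k p)) ⟩
  p %2^ k + 2 ^ k * b k p       ≡⟨ %2^-suc k p ⟨
  p %2^ suc k                   ∎

andSum-2^K∸1-high : ∀ K j p → andSum (K + j) p (2 ^ K ∸ 1) ≡ andSum K p (2 ^ K ∸ 1)
andSum-2^K∸1-high K zero    p = cong (λ k → andSum k p (2 ^ K ∸ 1)) (+-identityʳ K)
andSum-2^K∸1-high K (suc j) p = begin
  andSum (K + suc j) p m                 ≡⟨ cong (λ k → andSum k p m) (+-suc K j) ⟩
  andSum (K + j) p m + 2 ^ i * (b i p * b i m)
    ≡⟨ cong₂ (λ x y → x + 2 ^ i * (b i p * y)) (andSum-2^K∸1-high K j p) (b-2^k∸1-high (m≤m+n K j)) ⟩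
  andSum K p m + 2 ^ i * (b i p * 0)     ≡⟨ cong (λ x → andSum K p m + 2 ^ i * x) (*-zeroʳ (b i p)) ⟩
  andSum K p m + 2 ^ i * 0               ≡⟨ cong (andSum K p m +_) (*-zeroʳ (2 ^ i)) ⟩
  andSum K p m + 0                       ≡⟨ +-identityʳ _ ⟩
  andSum K p m                           ∎
  where
  m i : ℕ
  m = 2 ^ K ∸ 1
  i = K + j

&-2^K∸1 : ∀ K p → p & (2 ^ K ∸ 1) ≡ p %2^ K
&-2^K∸1 K p with ≤-total p K
... | inj₁ p≤K = begin
  andSum p p (2 ^ K ∸ 1) ≡⟨ andSum-2^K∸1-low {K} {p} p p≤K ⟩
  p %2^ p                ≡⟨ m<n⇒m%n≡m {{m^n≢0 2 p}} (n<2^n p) ⟩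
  p                      ≡⟨ m<n⇒m%n≡m {{m^n≢0 2 K}} (<-≤-trans (n<2^n p) (^-monoʳ-≤ 2 p≤K)) ⟨
  p %2^ K                ∎
... | inj₂ K≤p = begin
  andSum p p (2 ^ K ∸ 1)        ≡⟨ cong (λ k → andSum k p (2 ^ K ∸ 1)) (m+[n∸m]≡n K≤p) ⟨
  andSum (K + (p ∸ K)) p (2 ^ K ∸ 1) ≡⟨ andSum-2^K∸1-high K (p ∸ K) p ⟩
  andSum K p (2 ^ K ∸ 1)        ≡⟨ andSum-2^K∸1-low {K} {K} p ≤-refl ⟩
  p %2^ K                       ∎

&-2^K∸1-< : ∀ K {p} → p < 2 ^ K → p & (2 ^ K ∸ 1) ≡ p
&-2^K∸1-< K {p} p<2^K = trans (&-2^K∸1 K p) (m<n⇒m%n≡m {{m^n≢0 2 K}} p<2^K)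

&-2^K∸1-periodic : ∀ K p → (2 ^ K + p) & (2 ^ K ∸ 1) ≡ p & (2 ^ K ∸ 1)
&-2^K∸1-periodic K p = begin
  (2 ^ K + p) & (2 ^ K ∸ 1) ≡⟨ &-2^K∸1 K (2 ^ K + p) ⟩
  (2 ^ K + p) %2^ K         ≡⟨ cong (_%2^ K) (+-comm (2 ^ K) p) ⟩
  (p + 2 ^ K) %2^ K         ≡⟨ [m+n]%n≡m%n p (2 ^ K) {{m^n≢0 2 K}} ⟩
  p %2^ K                   ≡⟨ &-2^K∸1 K p ⟨
  p & (2 ^ K ∸ 1)           ∎

b-+ : ∀ e k {q r} → r < 2 ^ e → b (e + k) (q * 2 ^ e + r) ≡ b k q
b-+ e k {q} {r} r<2^e = cong (_% 2) (begin
  n / 2 ^ (e + k)         ≡⟨ /-congʳ (^-distribˡ-+-* 2 e k) ⟩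
  n / (2 ^ e * 2 ^ k)     ≡⟨ m/n/o≡m/[n*o] n (2 ^ e) (2 ^ k) ⟨
  n / 2 ^ e / 2 ^ k       ≡⟨ cong (_/ 2 ^ k) n/2^e≡q ⟩
  q / 2 ^ k               ∎)
  where
  n : ℕ
  n = q * 2 ^ e + r
  instance
    2^e≢0 : NonZero (2 ^ e)
    2^e≢0 = m^n≢0 2 e
    2^k≢0 : NonZero (2 ^ k)
    2^k≢0 = m^n≢0 2 k
    2^e+k≢0 : NonZero (2 ^ (e + k))
    2^e+k≢0 = m^n≢0 2 (e + k)
    2^e*2^k≢0 : NonZero (2 ^ e * 2 ^ k)
    2^e*2^k≢0 = m*n≢0 (2 ^ e) (2 ^ k)
  n/2^e≡q : n / 2 ^ e ≡ q
  n/2^e≡q = begin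
    (q * 2 ^ e + r) / 2 ^ e         ≡⟨ +-distrib-/-∣ˡ r (n∣m*n q) ⟩
    q * 2 ^ e / 2 ^ e + r / 2 ^ e   ≡⟨ cong₂ _+_ (m*n/n≡m q (2 ^ e)) (m<n⇒m/n≡0 r<2^e) ⟩
    q + 0                           ≡⟨ +-identityʳ q ⟩
    q                               ∎

term-cong : ∀ {m n n′ p p′} → p & m ≡ p′ & m → b p n ≡ b p′ n′ → term m n p ≡ term m n′ p′
term-cong {m} {p = p} {p′ = p′} p&m≡p′&m bₚn≡bₚ′n′ with p & m ≟ 0 | p′ & m ≟ 0
... | yes _      | yes _      = bₚn≡bₚ′n′
... | no  _      | no  _      = refl
... | yes p&m≡0  | no  p′&m≢0 = ⊥-elim (p′&m≢0 (trans (sym p&m≡p′&m) p&m≡0))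
... | no  p&m≢0  | yes p′&m≡0 = ⊥-elim (p&m≢0 (trans p&m≡p′&m p′&m≡0))

term-≢0 : ∀ {m n p} → p & m ≢ 0 → term m n p ≡ 0
term-≢0 {m} {p = p} p&m≢0 with p & m ≟ 0
... | yes p&m≡0 = ⊥-elim (p&m≢0 p&m≡0)
... | no  _     = refl

term-b≡0 : ∀ {m n p} → b p n ≡ 0 → term m n p ≡ 0
term-b≡0 {m} {p = p} bₚn≡0 with p & m ≟ 0
... | yes _ = bₚn≡0
... | no  _ = refl

%2-absorbˡ : ∀ x y → (x % 2 + y) % 2 ≡ (x + y) % 2
%2-absorbˡ x y = begin
  (x % 2 + y) % 2           ≡⟨ %-distribˡ-+ (x % 2) y 2 ⟩
  (x % 2 % 2 + y % 2) % 2   ≡⟨ cong (λ z → (z + y % 2) % 2) (m%n%n≡m%n x 2) ⟩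
  (x % 2 + y % 2) % 2       ≡⟨ %-distribˡ-+ x y 2 ⟨
  (x + y) % 2               ∎

suc-%2 : ∀ x → suc x % 2 ≡ 1 ∸ x % 2
suc-%2 0             = refl
suc-%2 1             = refl
suc-%2 (suc (suc x)) = suc-%2 x

⊕-identityʳ : ∀ x → x ⊕ 0 ≡ x % 2
⊕-identityʳ x = cong (_% 2) (+-identityʳ x)

⊕-assoc : ∀ x y z → (x ⊕ y) ⊕ z ≡ x ⊕ (y ⊕ z)
⊕-assoc x y z = begin
  ((x + y) % 2 + z) % 2     ≡⟨ %2-absorbˡ (x + y) z ⟩
  (x + y + z) % 2           ≡⟨ cong (_% 2) (+-assoc x y z) ⟩
  (x + (y + z)) % 2         ≡⟨ cong (_% 2) (+-comm x (y + z)) ⟩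
  (y + z + x) % 2           ≡⟨ %2-absorbˡ (y + z) x ⟨
  ((y + z) % 2 + x) % 2     ≡⟨ cong (_% 2) (+-comm ((y + z) % 2) x) ⟩
  (x + (y + z) % 2) % 2     ∎

xorUpTo-%2 : ∀ m n k → xorUpTo m n k % 2 ≡ xorUpTo m n k
xorUpTo-%2 m n zero    = refl
xorUpTo-%2 m n (suc k) = m%n%n≡m%n (xorUpTo m n k + term m n k) 2

xorUpTo-pad : ∀ {m n} k j → (∀ i → i < j → term m n (k + i) ≡ 0) →
              xorUpTo m n (k + j) ≡ xorUpTo m n k
xorUpTo-pad {m} {n} k zero    _      = cong (xorUpTo m n) (+-identityʳ k)
xorUpTo-pad {m} {n} k (suc j) vanish = begin
  xorUpTo m n (k + suc j)                 ≡⟨ cong (xorUpTo m n) (+-suc k j) ⟩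
  xorUpTo m n (k + j) ⊕ term m n (k + j)  ≡⟨ cong (xorUpTo m n (k + j) ⊕_) (vanish j (n<1+n j)) ⟩
  xorUpTo m n (k + j) ⊕ 0                 ≡⟨ ⊕-identityʳ (xorUpTo m n (k + j)) ⟩
  xorUpTo m n (k + j) % 2                 ≡⟨ xorUpTo-%2 m n (k + j) ⟩
  xorUpTo m n (k + j)                     ≡⟨ xorUpTo-pad k j (λ i i<j → vanish i (m<n⇒m<1+n i<j)) ⟩
  xorUpTo m n k                           ∎

xorUpTo-stable : ∀ m {n k} → n ≤ k → xorUpTo m n k ≡ a m n
xorUpTo-stable m {n} {k} n≤k = begin
  xorUpTo m n k               ≡⟨ cong (xorUpTo m n) (m+[n∸m]≡n n≤k) ⟨
  xorUpTo m n (n + (k ∸ n))   ≡⟨ xorUpTo-pad n (k ∸ n) (λ i _ → vanish i) ⟩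
  xorUpTo m n n               ∎
  where
  vanish : ∀ i → term m n (n + i) ≡ 0
  vanish i = term-b≡0 {m} {n} {n + i} (b-< {n + i} (<-≤-trans (n<2^n n) (^-monoʳ-≤ 2 (m≤m+n n i))))

module _ (K : ℕ) where
  private
    m : ℕ
    m = 2 ^ K ∸ 1
    B : ℕ
    B = Bsz K

  xorUpTo-2^K : ∀ n → xorUpTo m n (2 ^ K) ≡ n % 2
  xorUpTo-2^K n = begin
    xorUpTo m n (2 ^ K)           ≡⟨ cong (xorUpTo m n) (m+[n∸m]≡n (m^n>0 2 K)) ⟨
    xorUpTo m n (1 + (2 ^ K ∸ 1)) ≡⟨ xorUpTo-pad 1 (2 ^ K ∸ 1) vanish ⟩
    b 0 n % 2                     ≡⟨ cong (_% 2) (b-zero n) ⟩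
    n % 2 % 2                     ≡⟨ m%n%n≡m%n n 2 ⟩
    n % 2                         ∎
    where
    vanish : ∀ i → i < 2 ^ K ∸ 1 → term m n (1 + i) ≡ 0
    vanish i i<2^K∸1 = term-≢0 {m} {n} {1 + i} (1+n≢0 ∘ trans (sym (&-2^K∸1-< K 1+i<2^K)))
      where
      1+i<2^K : 1 + i < 2 ^ K
      1+i<2^K = subst (2 + i ≤_) (m+[n∸m]≡n (m^n>0 2 K)) (s≤s i<2^K∸1)

  xorUpTo-shift : ∀ q {r} → r < B → ∀ k →
                  xorUpTo m (q * B + r) (2 ^ K + k) ≡ (q * B + r) ⊕ xorUpTo m q k
  xorUpTo-shift q {r} r<B zero = begin
    xorUpTo m n (2 ^ K + 0)   ≡⟨ cong (xorUpTo m n) (+-identityʳ (2 ^ K)) ⟩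
    xorUpTo m n (2 ^ K)       ≡⟨ xorUpTo-2^K n ⟩
    n % 2                     ≡⟨ ⊕-identityʳ n ⟨
    n ⊕ 0                     ∎
    where
    n : ℕ
    n = q * B + r
  xorUpTo-shift q {r} r<B (suc k) = begin
    xorUpTo m n (2 ^ K + suc k)                           ≡⟨ cong (xorUpTo m n) (+-suc (2 ^ K) k) ⟩
    xorUpTo m n (2 ^ K + k) ⊕ term m n (2 ^ K + k)
      ≡⟨ cong₂ _⊕_ (xorUpTo-shift q r<B k)
                   (term-cong {m} {n} {q} {2 ^ K + k} {k} (&-2^K∸1-periodic K k) (b-+ (2 ^ K) k r<B)) ⟩
    (n ⊕ xorUpTo m q k) ⊕ term m q k                      ≡⟨ ⊕-assoc n _ _ ⟩
    n ⊕ xorUpTo m q (suc k)                               ∎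
    where
    n : ℕ
    n = q * B + r

  a-digit : ∀ q {r} → r < B → a m (q * B + r) ≡ r ⊕ a m q
  a-digit q {r} r<B = begin
    a m n                        ≡⟨ xorUpTo-stable m {n} {2 ^ K + n} (m≤n+m n (2 ^ K)) ⟨
    xorUpTo m n (2 ^ K + n)      ≡⟨ xorUpTo-shift q r<B n ⟩
    n ⊕ xorUpTo m q n            ≡⟨ cong (n ⊕_) (xorUpTo-stable m {q} {n} q≤n) ⟩
    (q * B + r + a m q) % 2      ≡⟨ cong (_% 2) (+-assoc (q * B) r (a m q)) ⟩
    (q * B + (r + a m q)) % 2    ≡⟨ %-remove-+ˡ (r + a m q) 2∣qB ⟩
    r ⊕ a m q                    ∎
    where
    n : ℕ
    n = q * B + r
    q≤n : q ≤ n
    q≤n = ≤-trans (m≤m*n q B {{m^n≢0 2 (2 ^ K)}}) (m≤m+n (q * B) r)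
    2∣qB : 2 ∣ q * B
    2∣qB = ∣-trans (2∣2^n (m^n>0 2 K)) (n∣m*n q)

  1<B : 1 < B
  1<B = ^-monoʳ-< 2 (s≤s (s≤s z≤n)) (m^n>0 2 K)

  next-block : ∀ q {r} → suc r ≡ B → suc (q * B + r) ≡ suc q * B + 0
  next-block q {r} 1+r≡B = begin
    suc (q * B + r)   ≡⟨ +-suc (q * B) r ⟨
    q * B + suc r     ≡⟨ cong (q * B +_) 1+r≡B ⟩
    q * B + B         ≡⟨ +-comm (q * B) B ⟩
    suc q * B         ≡⟨ +-identityʳ (suc q * B) ⟨
    suc q * B + 0     ∎

  Δ-interior : ∀ q r → suc r < B → Δ K (q * B + r) ≡ 1
  Δ-interior q r 1+r<B = begin
    a m n ⊕ a m (suc n)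
      ≡⟨ cong₂ _⊕_ (a-digit q (<-trans (n<1+n r) 1+r<B))
                   (trans (cong (a m) (sym (+-suc (q * B) r))) (a-digit q 1+r<B)) ⟩
    (r ⊕ a m q) ⊕ (suc r ⊕ a m q)           ≡⟨ %-distribˡ-+ (r + a m q) (suc r + a m q) 2 ⟨
    (r + a m q + (suc r + a m q)) % 2       ≡⟨ cong (_% 2) (double+1 r (a m q)) ⟩
    (1 + (r + a m q) * 2) % 2               ≡⟨ [m+kn]%n≡m%n 1 (r + a m q) 2 ⟩
    1                                       ∎
    where
    n : ℕ
    n = q * B + r
    double+1 : ∀ x y → x + y + (suc x + y) ≡ 1 + (x + y) * 2
    double+1 = solve-∀

  Δ-last : ∀ q → Δ K (q * B + (B ∸ 1)) ≡ 1 ∸ Δ K q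
  Δ-last q = begin
    a m n ⊕ a m (suc n)
      ≡⟨ cong₂ _⊕_ (a-digit q B∸1<B)
                   (trans (cong (a m) (next-block q 1+[B∸1]≡B)) (a-digit (suc q) (<-trans z<s 1<B))) ⟩
    ((B ∸ 1) ⊕ A) ⊕ (0 ⊕ A′)          ≡⟨ %-distribˡ-+ (B ∸ 1 + A) A′ 2 ⟨
    (B ∸ 1 + A + A′) % 2              ≡⟨ cong (_% 2) (+-assoc (B ∸ 1) A A′) ⟩
    (B ∸ 1 + (A + A′)) % 2            ≡⟨ %2-absorbˡ (B ∸ 1) (A + A′) ⟨
    ((B ∸ 1) % 2 + (A + A′)) % 2      ≡⟨ cong (λ x → (x + (A + A′)) % 2) B∸1-odd ⟩
    suc (A + A′) % 2                  ≡⟨ suc-%2 (A + A′) ⟩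
    1 ∸ Δ K q                         ∎
    where
    n A A′ : ℕ
    n = q * B + (B ∸ 1)
    A = a m q
    A′ = a m (suc q)
    1+[B∸1]≡B : 1 + (B ∸ 1) ≡ B
    1+[B∸1]≡B = m+[n∸m]≡n (<⇒≤ 1<B)
    B∸1<B : B ∸ 1 < B
    B∸1<B = ≤-reflexive 1+[B∸1]≡B
    B∸1-odd : (B ∸ 1) % 2 ≡ 1
    B∸1-odd = trans (sym (b-zero (B ∸ 1))) (b-2^k∸1-low (m^n>0 2 K))

  σ-interior : ∀ x {r} → suc r ≢ B → σ K x r ≡ 1
  σ-interior zero    _      = refl
  σ-interior (suc _) {r} 1+r≢B with suc r ≟ B
  ... | yes 1+r≡B = ⊥-elim (1+r≢B 1+r≡B)
  ... | no  _     = refl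

  σ-last : ∀ x {r} → suc r ≡ B → σ K x r ≡ 1 ∸ x
  σ-last zero    _      = refl
  σ-last (suc x) {r} 1+r≡B with suc r ≟ B
  ... | yes _     = sym (0∸n≡0 x)
  ... | no  1+r≢B = ⊥-elim (1+r≢B 1+r≡B)

  Δ-substitution : ∀ q r → r < B → Δ K (q * B + r) ≡ σ K (Δ K q) r
  Δ-substitution q r r<B with suc r ≟ B
  ... | no 1+r≢B  = trans (Δ-interior q r (≤∧≢⇒< r<B 1+r≢B)) (sym (σ-interior (Δ K q) 1+r≢B))
  ... | yes 1+r≡B = begin
    Δ K (q * B + r)         ≡⟨ cong (λ x → Δ K (q * B + x)) (cong (_∸ 1) 1+r≡B) ⟩
    Δ K (q * B + (B ∸ 1))   ≡⟨ Δ-last q ⟩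
    1 ∸ Δ K q               ≡⟨ σ-last (Δ K q) 1+r≡B ⟨
    σ K (Δ K q) r           ∎

  Δ-digit-or-next : ∀ q r → r < B → Δ K (q * B + r) ≡ 1 ⊎ Δ K (q * B + r + 1) ≡ 1
  Δ-digit-or-next q r r<B with suc r ≟ B
  ... | no 1+r≢B  = inj₁ (Δ-interior q r (≤∧≢⇒< r<B 1+r≢B))
  ... | yes 1+r≡B = inj₂ (subst (λ x → Δ K x ≡ 1) [1+q]*B+0≡n+1 (Δ-interior (suc q) 0 1<B))
    where
    [1+q]*B+0≡n+1 : suc q * B + 0 ≡ q * B + r + 1
    [1+q]*B+0≡n+1 = sym (trans (+-comm (q * B + r) 1) (next-block q 1+r≡B))

  Δ-or-next : ∀ n → Δ K n ≡ 1 ⊎ Δ K (n + 1) ≡ 1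
  Δ-or-next n = subst (λ x → Δ K x ≡ 1 ⊎ Δ K (x + 1) ≡ 1) n≡qB+r
                      (Δ-digit-or-next (n / B) (n % B) (m%n<n n B))
    where
    instance
      B≢0 : NonZero B
      B≢0 = m^n≢0 2 (2 ^ K)
    n≡qB+r : n / B * B + n % B ≡ n
    n≡qB+r = trans (+-comm (n / B * B) (n % B)) (sym (m≡m%n+[m/n]*n n B))

lemma45 : (K : ℕ) → K ≥ 1 →
            ((q r : ℕ) → r ≤ Bsz K ∸ 2 → Δ K (q * Bsz K + r) ≡ 1)
          × ((q : ℕ) → Δ K (q * Bsz K + (Bsz K ∸ 1)) ≡ 1 ∸ Δ K q)
          × (Δ K 0 ≡ 1 × ((q r : ℕ) → r < Bsz K → Δ K (q * Bsz K + r) ≡ σ K (Δ K q) r))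
          × ((n : ℕ) → ¬ (Δ K n ≡ 0 × Δ K (n + 1) ≡ 0))
lemma45 K _ = interior , Δ-last K , (refl , Δ-substitution K) , no-00
  where
  interior : ∀ q r → r ≤ Bsz K ∸ 2 → Δ K (q * Bsz K + r) ≡ 1
  interior q r r≤B∸2 =
    Δ-interior K q r (≤-trans (+-monoʳ-≤ 2 r≤B∸2) (≤-reflexive (m+[n∸m]≡n (1<B K))))
  no-00 : ∀ n → ¬ (Δ K n ≡ 0 × Δ K (n + 1) ≡ 0)
  no-00 n (Δn≡0 , Δ[n+1]≡0) with Δ-or-next K n
  ... | inj₁ Δn≡1     = 1+n≢0 (trans (sym Δn≡1) Δn≡0)
  ... | inj₂ Δ[n+1]≡1 = 1+n≢0 (trans (sym Δ[n+1]≡1) Δ[n+1]≡0)
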